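{- For every prime $p \geq 5$, $rb(\mathbb{Z}_p, 1) = 4$.
   Context: $\mathbb{Z}_n$ denotes the cyclic group of order $n$. An $r$-coloring of $\mathbb{Z}_n$ is a surjective map $c:\mathbb{Z}_n\to\{1,\dots,r\}$. For a fixed integer $k$, a triple is any $(x_1,x_2,x_3)\in\mathbb{Z}_n^3$ with $x_1+x_2\equiv kx_3 \pmod n$. A triple is rainbow under $c$ if $c(x_1),c(x_2),c(x_3)$ are pairwise distinct; $c$ is rainbow-free if no triple is rainbow. The rainbow number $rb(\mathbb{Z}_n,k)$ is the smallest positive integer $r$ such that every $r$-coloring of $\mathbb{Z}_n$ admits a rainbow triple (by convention $rb(\mathbb{Z}_n,k)=n+1$ if no such $r$ exists). -}

module Defs where

open import Data.Nat using (ℕ; _+_; _*_; _<_; _≤_; NonZero)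
open import Data.Nat.DivMod using (_%_)
open import Data.Fin using (Fin; toℕ)
open import Data.Product using (Σ; ∃; _×_)
open import Relation.Binary.PropositionalEquality using (_≡_; _≢_)
open import Relation.Nullary using (¬_)

-- ℤ_n is represented by Fin n (residues 0,…,n-1); equations are read mod n.

Surjective : ∀ {n r} → (Fin n → Fin r) → Set
Surjective {n} {r} c = ∀ (j : Fin r) → ∃ λ (x : Fin n) → c x ≡ j

IsTriple : (n k : ℕ) → .{{NonZero n}} → Fin n → Fin n → Fin n → Set
IsTriple n k x₁ x₂ x₃ = (toℕ x₁ + toℕ x₂) % n ≡ (k * toℕ x₃) % n

IsRainbow : ∀ {n r} → (Fin n → Fin r) → Fin n → Fin n → Fin n → Set
IsRainbow c x₁ x₂ x₃ = c x₁ ≢ c x₂ × c x₁ ≢ c x₃ × c x₂ ≢ c x₃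

HasRainbowTriple : (n k : ℕ) → .{{NonZero n}} → ∀ {r} → (Fin n → Fin r) → Set
HasRainbowTriple n k c =
  Σ (Fin n) λ x₁ → Σ (Fin n) λ x₂ → Σ (Fin n) λ x₃ →
    IsTriple n k x₁ x₂ x₃ × IsRainbow c x₁ x₂ x₃

AllColoringsRainbow : (n k r : ℕ) → .{{NonZero n}} → Set
AllColoringsRainbow n k r =
  (c : Fin n → Fin r) → Surjective c → HasRainbowTriple n k c

-- rb(ℤ_n, k) = r : r is the smallest positive integer such that every
-- r-coloring admits a rainbow triple.  (For r > n there are no r-colorings,
-- so such an r always exists and is ≤ n+1; this agrees with the convention
-- rb = n+1 when no r ≤ n works.)
RainbowNumber : (n k : ℕ) → .{{NonZero n}} → ℕ → Set
RainbowNumber n k r =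
  1 ≤ r × AllColoringsRainbow n k r ×
  (∀ s → 1 ≤ s → s < r → ¬ AllColoringsRainbow n k s)

-- Lower bound: colour 0 alone, ±1 with a second colour and everything else with a third.  A
-- rainbow solution of x₁ + x₂ = x₃ must use the colour of 0, so it is x + 0 = x or x + (−x) = 0,
-- and neither is rainbow because the colouring is symmetric under x ↦ −x.
--
-- Upper bound: in a rainbow-free colouring of ℤ_p take g, u, v whose colours G, U, V differ from
-- each other and from the colour of 0, with u + g again coloured U (two of the three colours
-- always admit such a pair).  Translation by g then keeps every element of colour V inside
-- colour V: otherwise the progression u, u + w, u + 2w, … (w of colour V) would stay in colour U
-- together with its g-translates, but it meets 0 since p is prime.  So v, v + g, v + 2g, … all
-- have colour V, and again this progression meets 0.
module Submission where

open import Defs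
open import Data.Nat using (ℕ; _≤_)
open import Data.Nat.Primality using (Prime; prime⇒nonZero)

open import Data.Empty using (⊥; ⊥-elim)
open import Data.Fin.Base using (Fin; zero; suc; toℕ; fromℕ<; inject≤; punchIn)
open import Data.Fin.Properties
  using (toℕ<n; toℕ-injective; toℕ-fromℕ<; fromℕ<-toℕ; fromℕ<-cong; toℕ-inject≤; toℕ≤pred[n];
         punchInᵢ≢i; punchIn-injective; any?)
  renaming (_≟_ to _≟ᶠ_)
open import Data.Nat.Base
  using (zero; suc; _+_; _*_; _∸_; _⊓_; _<_; NonZero; z≤n; s≤s; s≤s⁻¹; >-nonZero⁻¹)
open import Data.Nat.Coprimality using (Coprime; coprime-Bézout)
open import Data.Nat.DivMod using (_%_; _mod_; m%n<n; m<n⇒m%n≡m; m%n%n≡m%n; %-distribˡ-+)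
open import Data.Nat.Divisibility
  using (_∣_; _∤_; divides; _∣0; ∣-trans; n∣m*n; m%n≡0⇒n∣m; n∣m⇒m%n≡0)
open import Data.Nat.GCD using (module Bézout)
open import Data.Nat.Primality using (prime⇒irreducible)
open import Data.Nat.Properties
  using (_≟_; ≤-trans; *-identityˡ; *-identityʳ; *-assoc; *-distribˡ-+; +-identityʳ; +-comm;
         +-monoʳ-≤; +-mono-<; m≤m+n; ≤⇒≯; m+n≡0⇒m≡0; m+n∸m≡n; m∸[m∸n]≡n; m≤n⇒m⊓n≡m; ⊓-comm;
         +-commutativeSemigroup; m⊓n≤n; ⊓-glb; ≤-reflexive; n≤1+n; m<n⇒0<n∸m; m+n≤o⇒m≤o∸n; suc-pred)
open import Algebra.Properties.CommutativeSemigroup +-commutativeSemigroup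
  using (x∙yz≈xz∙y; x∙yz≈yx∙z; xy∙z≈xz∙y; xy∙z≈x∙zy)
open import Data.Nat.Tactic.RingSolver using (solve-∀)
open import Data.Product using (∃; _×_; _,_; proj₁; proj₂)
open import Data.Sum using (_⊎_; inj₁; inj₂; map; swap)
open import Function using (_∘_; id)
open import Relation.Binary.PropositionalEquality
open import Relation.Nullary using (¬_; Dec; yes; no)
open import Relation.Nullary.Decidable using (_×-dec_; ¬?)

Distinct₃ : {A : Set} → A → A → A → Set
Distinct₃ x y z = x ≢ y × x ≢ z × y ≢ z

third-colour : ∀ {r} {X Y Z : Fin r} → X ≢ Y → ¬ Distinct₃ X Y Z → Z ≡ X ⊎ Z ≡ Y
third-colour {X = X} {Y} {Z} X≢Y ¬distinct with Z ≟ᶠ X | Z ≟ᶠ Y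
... | yes Z≡X | _       = inj₁ Z≡X
... | no _    | yes Z≡Y = inj₂ Z≡Y
... | no Z≢X  | no Z≢Y  = ⊥-elim (¬distinct (X≢Y , Z≢X ∘ sym , Z≢Y ∘ sym))

common-colour : {A : Set} {X a b c : A} → X ≡ a ⊎ X ≡ b → X ≡ a ⊎ X ≡ c → b ≢ c → X ≡ a
common-colour (inj₁ X≡a) _          _   = X≡a
common-colour (inj₂ _)   (inj₁ X≡a) _   = X≡a
common-colour (inj₂ X≡b) (inj₂ X≡c) b≢c = ⊥-elim (b≢c (trans (sym X≡b) X≡c))

module _ {p : ℕ} (prime-p : Prime p) where

  prime∤⇒coprime : ∀ {s} → p ∤ s → Coprime s p
  prime∤⇒coprime p∤s (d∣s , d∣p) with prime⇒irreducible prime-p d∣p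
  ... | inj₁ d≡1  = d≡1
  ... | inj₂ refl = ⊥-elim (p∤s d∣s)

  ∃-negative-inverse : ∀ {s} → p ∤ s → ∃ λ t → p ∣ 1 + t * s
  ∃-negative-inverse {s} p∤s with coprime-Bézout (prime∤⇒coprime p∤s)
  ... | Bézout.-+ x y 1+xs≡yp = x , divides y 1+xs≡yp
  ... | Bézout.+- x y 1+yp≡xs = q * x , divides (1 + q * y) (begin
      1 + q * x * s         ≡⟨ cong (1 +_) (*-assoc q x s) ⟩
      1 + q * (x * s)       ≡⟨ cong (λ z → 1 + q * z) (sym 1+yp≡xs) ⟩
      1 + q * (1 + y * p)   ≡⟨ cong (λ z → 1 + q * (1 + y * z)) (sym 1+q≡p) ⟩
      1 + q * (1 + y * suc q) ≡⟨ unfold q y ⟩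
      (1 + q * y) * suc q   ≡⟨ cong ((1 + q * y) *_) 1+q≡p ⟩
      (1 + q * y) * p       ∎)
    where
    open ≡-Reasoning
    q : ℕ
    q = p ∸ 1
    1+q≡p : suc q ≡ p
    1+q≡p = suc-pred p {{prime⇒nonZero prime-p}}
    unfold : ∀ q y → 1 + q * (1 + y * suc q) ≡ (1 + q * y) * suc q
    unfold = solve-∀

  progression-hits-multiple : ∀ {s} → p ∤ s → ∀ u → ∃ λ i → p ∣ u + i * s
  progression-hits-multiple {s} p∤s u with t , p∣1+ts ← ∃-negative-inverse p∤s =
    u * t , subst (p ∣_) expand (∣-trans p∣1+ts (n∣m*n u))
    where
    open ≡-Reasoning
    expand : u * (1 + t * s) ≡ u + u * t * s
    expand = begin
      u * (1 + t * s)     ≡⟨ *-distribˡ-+ u 1 (t * s) ⟩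
      u * 1 + u * (t * s) ≡⟨ cong₂ _+_ (*-identityʳ u) (sym (*-assoc u t s)) ⟩
      u + u * t * s       ∎

-- A colouring of ℤ_p read off on representatives in ℕ.
module RainbowFree
  {p r : ℕ} (prime-p : Prime p) (col : ℕ → Fin r)
  (col-multiple : ∀ {a} → p ∣ a → col a ≡ col 0)
  (rainbow-free : ∀ a b → ¬ Distinct₃ (col a) (col b) (col (a + b)))
  where

  sum-colour : ∀ {a b} → col a ≢ col b → col (a + b) ≡ col a ⊎ col (a + b) ≡ col b
  sum-colour {a} {b} a≢b = third-colour a≢b (rainbow-free a b)

  summand-colour : ∀ {a b} → col a ≢ col (a + b) → col b ≡ col a ⊎ col b ≡ col (a + b)
  summand-colour {a} {b} a≢a+b =
    third-colour a≢a+b λ (a≢a+b , a≢b , a+b≢b) → rainbow-free a b (a≢b , a≢a+b , a+b≢b ∘ sym)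

  progression-meets-zero : ∀ {s} → col s ≢ col 0 → ∀ u → ∃ λ i → col (u + i * s) ≡ col 0
  progression-meets-zero s≢0 u
    with i , p∣u+is ← progression-hits-multiple prime-p (s≢0 ∘ col-multiple) u =
    i , col-multiple p∣u+is

  module _ {g u : ℕ} (g≢0 : col g ≢ col 0) (u≢0 : col u ≢ col 0) (g≢u : col g ≢ col u)
           (u+g≡u : col (u + g) ≡ col u) where

    TwinColoured : ℕ → Set
    TwinColoured x = col x ≡ col u × col (x + g) ≡ col u

    module _ {w : ℕ} (w≢g : col w ≢ col g) (w≢u : col w ≢ col u) where

      -- Since x + g has colour U, x + g + w has colour U or V = col w.  In the second case the
      -- triple x + (w + g) puts w + g into colour U or V, and the triple w + g into V or G.
      twin-step : ∀ {x} → TwinColoured x → col (w + g) ≡ col w ⊎ TwinColoured (x + w)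
      twin-step {x} (x≡u , x+g≡u) with sum-colour {x + g} {w} (w≢u ∘ sym ∘ trans (sym x+g≡u))
      ... | inj₂ x+g+w≡w = inj₁ (common-colour (sum-colour w≢g)
              (swap (map (λ e → trans e x≡u) (λ e → trans e x+[w+g]≡w)
                (summand-colour λ e → w≢u (trans (sym x+[w+g]≡w) (trans (sym e) x≡u)))))
              g≢u)
        where
        x+[w+g]≡w : col (x + (w + g)) ≡ col w
        x+[w+g]≡w = trans (cong col (x∙yz≈xz∙y x w g)) x+g+w≡w
      ... | inj₁ x+g+w≡x+g = inj₂ (x+w≡u , trans (cong col (xy∙z≈xz∙y x w g)) x+g+w≡u)
        where
        x+g+w≡u : col (x + g + w) ≡ col u
        x+g+w≡u = trans x+g+w≡x+g x+g≡u
        g+[x+w]≡u : col (g + (x + w)) ≡ col u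
        g+[x+w]≡u = trans (cong col (x∙yz≈yx∙z g x w)) x+g+w≡u
        x+w≡u : col (x + w) ≡ col u
        x+w≡u = common-colour
          (map (λ e → trans e x≡u) id (sum-colour (w≢u ∘ sym ∘ trans (sym x≡u))))
          (swap (map id (λ e → trans e g+[x+w]≡u) (summand-colour (g≢u ∘ λ e → trans e g+[x+w]≡u))))
          w≢g

      preserved⊎twin-progression : ∀ i → col (w + g) ≡ col w ⊎ TwinColoured (u + i * w)
      preserved⊎twin-progression zero =
        inj₂ (subst TwinColoured (sym (+-identityʳ u)) (refl , u+g≡u))
      preserved⊎twin-progression (suc i) with preserved⊎twin-progression i
      ... | inj₁ preserved = inj₁ preserved
      ... | inj₂ twin      = map id (subst TwinColoured (xy∙z≈x∙zy u (i * w) w)) (twin-step twin)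

    translation-preserves-colour : ∀ {w} → col w ≢ col 0 → col w ≢ col g → col w ≢ col u →
                                   col (w + g) ≡ col w
    translation-preserves-colour w≢0 w≢g w≢u with i , ≡0 ← progression-meets-zero w≢0 u
      with preserved⊎twin-progression w≢g w≢u i
    ... | inj₁ preserved = preserved
    ... | inj₂ (≡u , _)  = ⊥-elim (u≢0 (trans (sym ≡u) ≡0))

    no-fourth-colour : ∀ {v} → col v ≢ col 0 → col v ≢ col g → col v ≢ col u → ⊥
    no-fourth-colour {v} v≢0 v≢g v≢u with i , ≡0 ← progression-meets-zero g≢0 v =
      v≢0 (trans (sym (translates i)) ≡0)
      where
      translates : ∀ i → col (v + i * g) ≡ col v
      translates zero    = cong col (+-identityʳ v)
      translates (suc i) = begin
        col (v + suc i * g)   ≡⟨ cong col (sym (xy∙z≈x∙zy v (i * g) g)) ⟩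
        col (v + i * g + g)   ≡⟨ translation-preserves-colour (avoid v≢0) (avoid v≢g) (avoid v≢u) ⟩
        col (v + i * g)       ≡⟨ translates i ⟩
        col v                 ∎
        where
        open ≡-Reasoning
        avoid : ∀ {X} → col v ≢ X → col (v + i * g) ≢ X
        avoid v≢X = v≢X ∘ trans (sym (translates i))

  no-four-colours : ∀ {a b v} → col a ≢ col 0 → col b ≢ col 0 → col v ≢ col 0 →
                    Distinct₃ (col a) (col b) (col v) → ⊥
  no-four-colours {a} {b} a≢0 b≢0 v≢0 (a≢b , a≢v , b≢v) with sum-colour a≢b
  ... | inj₁ a+b≡a = no-fourth-colour b≢0 a≢0 (a≢b ∘ sym) a+b≡a v≢0 (b≢v ∘ sym) (a≢v ∘ sym)
  ... | inj₂ a+b≡b =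
    no-fourth-colour a≢0 b≢0 a≢b (trans (cong col (+-comm b a)) a+b≡b) v≢0 (a≢v ∘ sym) (b≢v ∘ sym)

module _ {n : ℕ} .{{_ : NonZero n}} where

  toℕ-mod : ∀ a → toℕ (a mod n) ≡ a % n
  toℕ-mod a = toℕ-fromℕ< (m%n<n a n)

  mod-cong : ∀ {a b} → a % n ≡ b % n → a mod n ≡ b mod n
  mod-cong a≡b = fromℕ<-cong _ _ a≡b _ _

  toℕ-mod-inverse : ∀ (x : Fin n) → toℕ x mod n ≡ x
  toℕ-mod-inverse x = trans (fromℕ<-cong _ _ (m<n⇒m%n≡m (toℕ<n x)) _ (toℕ<n x)) (fromℕ<-toℕ x _)

  toℕ-%-injective : ∀ {x y : Fin n} → toℕ x % n ≡ toℕ y % n → x ≡ y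
  toℕ-%-injective {x} {y} x≡y =
    toℕ-injective (trans (sym (m<n⇒m%n≡m (toℕ<n x))) (trans x≡y (m<n⇒m%n≡m (toℕ<n y))))

  mod-isTriple : ∀ a b → IsTriple n 1 (a mod n) (b mod n) ((a + b) mod n)
  mod-isTriple a b = begin
    (toℕ (a mod n) + toℕ (b mod n)) % n ≡⟨ cong₂ (λ x y → (x + y) % n) (toℕ-mod a) (toℕ-mod b) ⟩
    (a % n + b % n) % n               ≡⟨ sym (%-distribˡ-+ a b n) ⟩
    (a + b) % n                       ≡⟨ sym (m%n%n≡m%n (a + b) n) ⟩
    (a + b) % n % n                   ≡⟨ cong (_% n) (sym (toℕ-mod (a + b))) ⟩
    toℕ ((a + b) mod n) % n           ≡⟨ cong (_% n) (sym (*-identityˡ _)) ⟩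
    (1 * toℕ ((a + b) mod n)) % n     ∎
    where open ≡-Reasoning

  sum-of-residues-divisible : ∀ {a b} → a < n → b < n → (a + b) % n ≡ 0 → a + b ≡ 0 ⊎ a + b ≡ n
  sum-of-residues-divisible {a} {b} a<n b<n n∣a+b with m%n≡0⇒n∣m (a + b) n n∣a+b
  ... | divides zero          a+b≡0  = inj₁ a+b≡0
  ... | divides (suc zero)    a+b≡n  = inj₂ (trans a+b≡n (+-identityʳ n))
  ... | divides (suc (suc q)) a+b≡qn = ⊥-elim (≤⇒≯ (subst (n + n ≤_) (sym a+b≡qn)
        (+-monoʳ-≤ n (m≤m+n n (q * n)))) (+-mono-< a<n b<n))

  hasRainbowTriple? : ∀ {k r} (c : Fin n → Fin r) → Dec (HasRainbowTriple n k c)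
  hasRainbowTriple? {k} c = any? λ x₁ → any? λ x₂ → any? λ x₃ →
    ((toℕ x₁ + toℕ x₂) % n ≟ (k * toℕ x₃) % n) ×-dec
    (¬? (c x₁ ≟ᶠ c x₂) ×-dec ¬? (c x₁ ≟ᶠ c x₃) ×-dec ¬? (c x₂ ≟ᶠ c x₃))

  allColoringsRainbow[4+r] : ∀ r → Prime n → AllColoringsRainbow n 1 (4 + r)
  allColoringsRainbow[4+r] r prime-n c surj with hasRainbowTriple? {k = 1} c
  ... | yes rainbow = rainbow
  ... | no rainbow-free = ⊥-elim (no-four-colours (avoids-0 zero) (avoids-0 (suc zero))
        (avoids-0 (suc (suc zero))) (distinct (λ ()) , distinct (λ ()) , distinct (λ ())))
    where
    col : ℕ → Fin (4 + r)
    col a = c (a mod n)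

    open RainbowFree prime-n col
      (λ {a} n∣a → cong c (mod-cong (trans (n∣m⇒m%n≡0 a n n∣a) (sym (n∣m⇒m%n≡0 0 n (n ∣0))))))
      (λ a b distinct → rainbow-free (a mod n , b mod n , (a + b) mod n , mod-isTriple a b , distinct))

    pick : Fin (3 + r) → ℕ
    pick j = toℕ (proj₁ (surj (punchIn (col 0) j)))

    col-pick : ∀ j → col (pick j) ≡ punchIn (col 0) j
    col-pick j = trans (cong c (toℕ-mod-inverse _)) (proj₂ (surj (punchIn (col 0) j)))

    avoids-0 : ∀ j → col (pick j) ≢ col 0
    avoids-0 j = punchInᵢ≢i (col 0) j ∘ trans (sym (col-pick j))

    distinct : ∀ {j k} → j ≢ k → col (pick j) ≢ col (pick k)
    distinct {j} {k} j≢k e =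
      j≢k (punchIn-injective (col 0) j k (trans (sym (col-pick j)) (trans e (col-pick k))))

clamp : ∀ {s} t → Fin s → Fin (suc t)
clamp t i = fromℕ< (s≤s (m⊓n≤n (toℕ i) t))

clamp-surjective : ∀ {s t} → t < s → Surjective (clamp {s} t)
clamp-surjective {t = t} t<s j =
  inject≤ j t<s , trans (fromℕ<-cong _ _ j⊓t≡j _ _) (fromℕ<-toℕ j (toℕ<n j))
  where
  j⊓t≡j : toℕ (inject≤ j t<s) ⊓ t ≡ toℕ j
  j⊓t≡j = trans (cong (_⊓ t) (toℕ-inject≤ j t<s)) (m≤n⇒m⊓n≡m (toℕ≤pred[n] j))

∘-surjective : ∀ {m s t} {f : Fin s → Fin t} {c : Fin m → Fin s} →
               Surjective f → Surjective c → Surjective (f ∘ c)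
∘-surjective {f = f} f-surj c-surj j with i , i↦j ← f-surj j with x , x↦i ← c-surj i =
  x , trans (cong f x↦i) i↦j

-- Merging colours cannot create a rainbow triple.
allColoringsRainbow-mono : ∀ {n k s t} .{{_ : NonZero n}} → t < s →
                           AllColoringsRainbow n k (suc t) → AllColoringsRainbow n k s
allColoringsRainbow-mono {t = t} t<s all c surj
  with x₁ , x₂ , x₃ , triple , (d₁₂ , d₁₃ , d₂₃)
         ← all (clamp t ∘ c) (∘-surjective (clamp-surjective t<s) surj) =
  x₁ , x₂ , x₃ , triple , d₁₂ ∘ cong (clamp t) , d₁₃ ∘ cong (clamp t) , d₂₃ ∘ cong (clamp t)

distinct₃⇒zero : ∀ {i j k : Fin 3} → Distinct₃ i j k → i ≡ zero ⊎ j ≡ zero ⊎ k ≡ zero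
distinct₃⇒zero {zero}                    _           = inj₁ refl
distinct₃⇒zero {suc _} {zero}            _           = inj₂ (inj₁ refl)
distinct₃⇒zero {suc _} {suc _} {zero}    _           = inj₂ (inj₂ refl)
distinct₃⇒zero {suc zero}       {suc zero}       (i≢j , _)   = ⊥-elim (i≢j refl)
distinct₃⇒zero {suc (suc zero)} {suc (suc zero)} (i≢j , _)   = ⊥-elim (i≢j refl)
distinct₃⇒zero {suc zero}       {suc (suc zero)} {suc zero}       (_ , i≢k , _) = ⊥-elim (i≢k refl)
distinct₃⇒zero {suc zero}       {suc (suc zero)} {suc (suc zero)} (_ , _ , j≢k) = ⊥-elim (j≢k refl)
distinct₃⇒zero {suc (suc zero)} {suc zero}       {suc zero}       (_ , _ , j≢k) = ⊥-elim (j≢k refl)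
distinct₃⇒zero {suc (suc zero)} {suc zero}       {suc (suc zero)} (_ , i≢k , _) = ⊥-elim (i≢k refl)

module SymmetricColouring (n : ℕ) .{{_ : NonZero n}} where

  -- the distance from a residue a ≤ n to 0 in ℤ_n
  ∣_∣ : ℕ → ℕ
  ∣ a ∣ = a ⊓ (n ∸ a)

  ∣n∸a∣≡∣a∣ : ∀ {a} → a ≤ n → ∣ n ∸ a ∣ ≡ ∣ a ∣
  ∣n∸a∣≡∣a∣ {a} a≤n = trans (cong ((n ∸ a) ⊓_) (m∸[m∸n]≡n a≤n)) (⊓-comm (n ∸ a) a)

  distance-colour : ℕ → Fin 3
  distance-colour zero          = zero
  distance-colour (suc zero)    = suc zero
  distance-colour (suc (suc _)) = suc (suc zero)

  colouring : Fin n → Fin 3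
  colouring x = distance-colour ∣ toℕ x ∣

  distance-colour≢zero : ∀ {d} → 0 < d → distance-colour d ≢ zero
  distance-colour≢zero {suc zero}    _ ()
  distance-colour≢zero {suc (suc _)} _ ()

  colour-zero : ∀ {a} → a < n → distance-colour ∣ a ∣ ≡ zero → a ≡ 0
  colour-zero {zero}  _   _   = refl
  colour-zero {suc a} a<n a↦0 =
    ⊥-elim (distance-colour≢zero (⊓-glb (s≤s z≤n) (m<n⇒0<n∸m a<n)) a↦0)

  rainbow-free : ¬ HasRainbowTriple n 1 colouring
  rainbow-free (x₁ , x₂ , x₃ , triple , rainbow) = no-rainbow (distinct₃⇒zero rainbow) rainbow
    where
    a b : ℕ
    a = toℕ x₁
    b = toℕ x₂

    a+b≡x₃ : (a + b) % n ≡ toℕ x₃ % n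
    a+b≡x₃ = trans triple (cong (_% n) (*-identityˡ (toℕ x₃)))

    no-rainbow : colouring x₁ ≡ zero ⊎ colouring x₂ ≡ zero ⊎ colouring x₃ ≡ zero →
                 IsRainbow colouring x₁ x₂ x₃ → ⊥
    no-rainbow (inj₁ x₁↦0) (_ , _ , d₂₃) = d₂₃ (cong colouring (toℕ-%-injective
      (trans (cong (λ a → (a + b) % n) (sym (colour-zero (toℕ<n x₁) x₁↦0))) a+b≡x₃)))
    no-rainbow (inj₂ (inj₁ x₂↦0)) (_ , d₁₃ , _) = d₁₃ (cong colouring (toℕ-%-injective
      (trans (cong (_% n) (sym (+-identityʳ a)))
        (trans (cong (λ b → (a + b) % n) (sym (colour-zero (toℕ<n x₂) x₂↦0))) a+b≡x₃))))
    no-rainbow (inj₂ (inj₂ x₃↦0)) (d₁₂ , d₁₃ , _)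
      with x₃≡0 ← colour-zero (toℕ<n x₃) x₃↦0
      with sum-of-residues-divisible (toℕ<n x₁) (toℕ<n x₂)
             (trans a+b≡x₃ (trans (cong (_% n) x₃≡0) (m<n⇒m%n≡m (>-nonZero⁻¹ n))))
    ... | inj₁ a+b≡0 = d₁₃ (cong colouring (toℕ-injective (trans (m+n≡0⇒m≡0 a a+b≡0) (sym x₃≡0))))
    ... | inj₂ a+b≡n = d₁₂ (cong distance-colour (sym (begin
      ∣ b ∣         ≡⟨ cong ∣_∣ (trans (sym (m+n∸m≡n a b)) (cong (_∸ a) a+b≡n)) ⟩
      ∣ n ∸ a ∣     ≡⟨ ∣n∸a∣≡∣a∣ (≤-trans (m≤m+n a b) (≤-reflexive a+b≡n)) ⟩
      ∣ a ∣         ∎)))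
      where open ≡-Reasoning

  colouring-hits : ∀ d → d < n → d + d ≤ n → ∃ λ x → colouring x ≡ distance-colour d
  colouring-hits d d<n 2d≤n = fromℕ< d<n , cong distance-colour
    (trans (cong ∣_∣ (toℕ-fromℕ< d<n)) (m≤n⇒m⊓n≡m (m+n≤o⇒m≤o∸n d 2d≤n)))

  surjective : 4 ≤ n → Surjective colouring
  surjective 4≤n zero             = colouring-hits 0 (>-nonZero⁻¹ n) z≤n
  surjective 4≤n (suc zero)       = colouring-hits 1 2≤n 2≤n
    where
    2≤n : 2 ≤ n
    2≤n = ≤-trans (s≤s (s≤s z≤n)) 4≤n
  surjective 4≤n (suc (suc zero)) = colouring-hits 2 (≤-trans (s≤s (s≤s (s≤s z≤n))) 4≤n) 4≤n

  ¬allColoringsRainbow[3] : 4 ≤ n → ¬ AllColoringsRainbow n 1 3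
  ¬allColoringsRainbow[3] 4≤n all = rainbow-free (all colouring (surjective 4≤n))

theorem1 : (p : ℕ) → (pr : Prime p) → 5 ≤ p →
    RainbowNumber p 1 {{prime⇒nonZero pr}} 4
theorem1 p pr 5≤p = s≤s z≤n , allColoringsRainbow[4+r] 0 pr , fewer-colours
  where
  instance
    nonZero-p : NonZero p
    nonZero-p = prime⇒nonZero pr

  fewer-colours : ∀ s → 1 ≤ s → s < 4 → ¬ AllColoringsRainbow p 1 s
  fewer-colours (suc t) _ s<4 =
    SymmetricColouring.¬allColoringsRainbow[3] p (≤-trans (n≤1+n 4) 5≤p)
    ∘ allColoringsRainbow-mono {k = 1} (s≤s⁻¹ s<4)
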